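{- Let $(\mathscr{A},\preccurlyeq,\to)$ be a complete Heyting algebra (viewed as an implicative structure with Heyting's implication). Then the following are equivalent: (1) $(\mathscr{A},\preccurlyeq,\to)$ is a (complete) Boolean algebra; (2) $\mathtt{cc}^{\mathscr{A}}=\top$; (3) $t^{\mathscr{A}}=\top$ for all closed $\lambda$-terms $t$ possibly containing the constant $\mathtt{cc}$.
   Context: In an implicative structure (complete lattice with meets $\bigwedge$, top $\top$, and an implication anti-monotonic/monotonic commuting with meets in its second argument; a complete Heyting algebra with its Heyting implication is one), application is $ab=\bigwedge\{c:a\preccurlyeq(b\to c)\}$, abstraction of $f$ is $\bigwedge_a(a\to f(a))$, closed $\lambda$-terms with parameters are interpreted as $t^{\mathscr{A}}$ accordingly, and the constant $\mathtt{cc}$ is interpreted by $\mathtt{cc}^{\mathscr{A}}=\bigwedge_{a,b\in\mathscr{A}}(((a\to b)\to a)\to a)$ (Peirce's law). -}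

module Defs where

open import Data.Nat using (ℕ; suc)
open import Data.Fin using (Fin; zero; suc)
open import Data.Bool using (Bool; true; false; if_then_else_)
open import Data.Empty using (⊥)
open import Data.Product using (Σ; _×_; _,_; proj₁; ∃)
open import Relation.Binary.PropositionalEquality using (_≡_)

record CompleteHeytingAlgebra : Set₁ where
  field
    Carrier : Set
    _≤_     : Carrier → Carrier → Set
    ≤-refl  : ∀ {a} → a ≤ a
    ≤-trans : ∀ {a b c} → a ≤ b → b ≤ c → a ≤ c
    ≤-antisym : ∀ {a b} → a ≤ b → b ≤ a → a ≡ b
    ⋀       : {I : Set} → (I → Carrier) → Carrier
    ⋀-lower : ∀ {I} (f : I → Carrier) (i : I) → ⋀ f ≤ f i
    ⋀-greatest : ∀ {I} (f : I → Carrier) (x : Carrier) → (∀ i → x ≤ f i) → x ≤ ⋀ f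
    _⇒_     : Carrier → Carrier → Carrier

  infixr 5 _⇒_
  infixr 7 _∧_
  infixr 6 _∨_

  _∧_ : Carrier → Carrier → Carrier
  a ∧ b = ⋀ (λ (i : Bool) → if i then a else b)

  ⊤ₐ : Carrier
  ⊤ₐ = ⋀ (λ (i : ⊥) → Data.Empty.⊥-elim i)

  ⊥ₐ : Carrier
  ⊥ₐ = ⋀ (λ (x : Carrier) → x)

  _∨_ : Carrier → Carrier → Carrier
  a ∨ b = ⋀ (λ (p : Σ Carrier (λ c → a ≤ c × b ≤ c)) → proj₁ p)

  field
    ⇒-intro : ∀ {a b c} → (c ∧ a) ≤ b → c ≤ (a ⇒ b)
    ⇒-elim  : ∀ {a b c} → c ≤ (a ⇒ b) → (c ∧ a) ≤ b

module _ (H : CompleteHeytingAlgebra) where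
  open CompleteHeytingAlgebra H

  -- (1) the lattice is a Boolean algebra: every element has a complement
  -- (distributivity holds automatically in a Heyting algebra)
  IsBoolean : Set
  IsBoolean = ∀ (a : Carrier) → ∃ λ b → (a ∧ b ≡ ⊥ₐ) × (a ∨ b ≡ ⊤ₐ)

  app : Carrier → Carrier → Carrier
  app a b = ⋀ (λ (p : Σ Carrier (λ c → a ≤ (b ⇒ c))) → proj₁ p)

  abs : (Carrier → Carrier) → Carrier
  abs f = ⋀ (λ a → a ⇒ f a)

  ccᴬ : Carrier
  ccᴬ = ⋀ (λ (p : Carrier × Carrier) → ((proj₁ p ⇒ Data.Product.proj₂ p) ⇒ proj₁ p) ⇒ proj₁ p)

data Term (n : ℕ) : Set where
  var : Fin n → Term n
  ƛ   : Term (suc n) → Term n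
  _·_ : Term n → Term n → Term n
  cc  : Term n

extend : {A : Set} {n : ℕ} → (Fin n → A) → A → Fin (suc n) → A
extend ρ a zero    = a
extend ρ a (suc i) = ρ i

module _ (H : CompleteHeytingAlgebra) where
  open CompleteHeytingAlgebra H

  ⟦_⟧ : ∀ {n} → Term n → (Fin n → Carrier) → Carrier
  ⟦ var i ⟧ ρ = ρ i
  ⟦ ƛ t ⟧ ρ   = abs H (λ a → ⟦ t ⟧ (extend ρ a))
  ⟦ t · u ⟧ ρ = app H (⟦ t ⟧ ρ) (⟦ u ⟧ ρ)
  ⟦ cc ⟧ ρ    = ccᴬ H

  ⟦_⟧₀ : Term 0 → Carrier
  ⟦ t ⟧₀ = ⟦ t ⟧ (λ ())

module Submission where

-- Everything goes through Peirce's law in the order-theoretic form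
-- ((a ⇒ b) ⇒ a) ≤ a.  Since ⊤ ≤ (x ⇒ y) exactly when x ≤ y, the meet ccᴬ of
-- all Peirce instances is ⊤ iff Peirce's law holds.
--   (1) ⇒ Peirce: split ⊤ = a ∨ c along a complement c of a; on c we have
--       c ≤ a ⇒ b, so modus ponens gives a.
--   Peirce ⇒ (1): the pseudo-complement ¬a = a ⇒ ⊥ is a complement, since
--       Peirce for y = a ∨ ¬a and b = ⊥ yields excluded middle ⊤ ≤ a ∨ ¬a.
--   (2) ⇒ (3): application and abstraction satisfy a ∧ b ≤ a b and
--       (∀ a, x ∧ a ≤ f a) ⇒ x ≤ λf, so by induction on terms any x below
--       ccᴬ and below all free variables lies below the denotation; take x = ⊤.
--   (3) ⇒ (2): instantiate (3) with the term cc.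

open import Defs
open import Data.Product using (_×_; _,_; proj₁; proj₂; Σ)
open import Data.Bool using (true; false)
open import Data.Fin using (Fin; zero; suc)
open import Function.Bundles using (_⇔_; mk⇔)
open import Relation.Binary.PropositionalEquality using (_≡_; subst; sym)

module HeytingFacts (H : CompleteHeytingAlgebra) where
  open CompleteHeytingAlgebra H

  ∧-fst : ∀ {a b} → (a ∧ b) ≤ a
  ∧-fst = ⋀-lower _ true

  ∧-snd : ∀ {a b} → (a ∧ b) ≤ b
  ∧-snd = ⋀-lower _ false

  ∧-pair : ∀ {x a b} → x ≤ a → x ≤ b → x ≤ (a ∧ b)
  ∧-pair {x} p q = ⋀-greatest _ x λ { true → p ; false → q }

  ∧-swap : ∀ {a b} → (a ∧ b) ≤ (b ∧ a)
  ∧-swap = ∧-pair ∧-snd ∧-fst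

  ⊤-greatest : ∀ {x} → x ≤ ⊤ₐ
  ⊤-greatest {x} = ⋀-greatest _ x λ ()

  ⊤-unique : ∀ {x} → ⊤ₐ ≤ x → x ≡ ⊤ₐ
  ⊤-unique p = ≤-antisym ⊤-greatest p

  ⊥-least : ∀ {x} → ⊥ₐ ≤ x
  ⊥-least {x} = ⋀-lower (λ y → y) x

  ∨-inl : ∀ {a b} → a ≤ (a ∨ b)
  ∨-inl = ⋀-greatest _ _ λ u → proj₁ (proj₂ u)

  ∨-inr : ∀ {a b} → b ≤ (a ∨ b)
  ∨-inr = ⋀-greatest _ _ λ u → proj₂ (proj₂ u)

  ∨-least : ∀ {a b y} → a ≤ y → b ≤ y → (a ∨ b) ≤ y
  ∨-least {a} {b} {y} p q = ⋀-lower (λ (u : Σ Carrier (λ c → a ≤ c × b ≤ c)) → proj₁ u) (y , p , q)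

  modus-ponens : ∀ {a b} → ((a ⇒ b) ∧ a) ≤ b
  modus-ponens = ⇒-elim ≤-refl

  ⇒-valid : ∀ {x y z} → x ≤ y → z ≤ (x ⇒ y)
  ⇒-valid p = ⇒-intro (≤-trans ∧-snd p)

  valid-⇒ : ∀ {x y} → ⊤ₐ ≤ (x ⇒ y) → x ≤ y
  valid-⇒ p = ≤-trans (∧-pair ⊤-greatest ≤-refl) (⇒-elim p)

  ⇒-antitone : ∀ {a y z} → a ≤ y → (y ⇒ z) ≤ (a ⇒ z)
  ⇒-antitone a≤y = ⇒-intro (≤-trans (∧-pair ∧-fst (≤-trans ∧-snd a≤y)) modus-ponens)

  join-cases : ∀ {a c x y} → ⊤ₐ ≤ (a ∨ c) →
               (a ∧ x) ≤ y → (c ∧ x) ≤ y → x ≤ y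
  join-cases cover ax≤y cx≤y =
    valid-⇒ (≤-trans cover (∨-least (⇒-intro ax≤y) (⇒-intro cx≤y)))

  ¬ₐ : Carrier → Carrier
  ¬ₐ a = a ⇒ ⊥ₐ

  noncontradiction : ∀ {a} → (a ∧ ¬ₐ a) ≡ ⊥ₐ
  noncontradiction = ≤-antisym (≤-trans ∧-swap modus-ponens) ⊥-least

  disjoint-⇒ : ∀ {a c b} → (a ∧ c) ≡ ⊥ₐ → c ≤ (a ⇒ b)
  disjoint-⇒ {a} {c} {b} disj =
    ⇒-intro (≤-trans ∧-swap (subst (λ z → z ≤ b) (sym disj) ⊥-least))

  PeirceLaw : Set
  PeirceLaw = ∀ a b → ((a ⇒ b) ⇒ a) ≤ a

  cc-top→peirce : ccᴬ H ≡ ⊤ₐ → PeirceLaw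
  cc-top→peirce cc≡⊤ a b =
    valid-⇒ (subst (λ z → z ≤ (((a ⇒ b) ⇒ a) ⇒ a)) cc≡⊤ (⋀-lower _ (a , b)))

  peirce→cc-top : PeirceLaw → ccᴬ H ≡ ⊤ₐ
  peirce→cc-top peirce =
    ⊤-unique (⋀-greatest _ _ λ ab → ⇒-valid (peirce (proj₁ ab) (proj₂ ab)))

  boolean→peirce : IsBoolean H → PeirceLaw
  boolean→peirce boolean a b =
    join-cases cover ∧-fst
      (≤-trans (∧-pair ∧-snd (≤-trans ∧-fst c≤a⇒b)) modus-ponens)
    where
    c : Carrier
    c = proj₁ (boolean a)

    c≤a⇒b : c ≤ (a ⇒ b)
    c≤a⇒b = disjoint-⇒ (proj₁ (proj₂ (boolean a)))

    cover : ⊤ₐ ≤ (a ∨ c)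
    cover = subst (⊤ₐ ≤_) (sym (proj₂ (proj₂ (boolean a)))) ≤-refl

  -- Peirce ⇒ excluded middle, via Peirce at y = a ∨ ¬a and b = ⊥,
  -- using ¬y ≤ ¬a ≤ y.
  peirce→excluded-middle : PeirceLaw → ∀ a → ⊤ₐ ≤ (a ∨ ¬ₐ a)
  peirce→excluded-middle peirce a =
    ≤-trans (⇒-valid (≤-trans (⇒-antitone ∨-inl) ∨-inr)) (peirce (a ∨ ¬ₐ a) ⊥ₐ)

  peirce→boolean : PeirceLaw → IsBoolean H
  peirce→boolean peirce a =
    ¬ₐ a , noncontradiction , ⊤-unique (peirce→excluded-middle peirce a)

  ∧-≤-app : ∀ {a b} → (a ∧ b) ≤ app H a b
  ∧-≤-app = ⋀-greatest _ _ λ u → ⇒-elim (proj₂ u)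

  abs-intro : ∀ {x} (f : Carrier → Carrier) → (∀ a → (x ∧ a) ≤ f a) → x ≤ abs H f
  abs-intro {x} f body = ⋀-greatest _ x λ a → ⇒-intro (body a)

  denotation-lower : ∀ {n} (t : Term n) (ρ : Fin n → Carrier) {x : Carrier} →
                     x ≤ ccᴬ H → (∀ i → x ≤ ρ i) → x ≤ ⟦_⟧ H t ρ
  denotation-lower (var i) ρ x≤cc x≤ρ = x≤ρ i
  denotation-lower (ƛ t) ρ x≤cc x≤ρ = abs-intro _ λ a →
    denotation-lower t (extend ρ a) (≤-trans ∧-fst x≤cc)
      λ { zero → ∧-snd ; (suc i) → ≤-trans ∧-fst (x≤ρ i) }
  denotation-lower (t · u) ρ x≤cc x≤ρ =
    ≤-trans (∧-pair (denotation-lower t ρ x≤cc x≤ρ) (denotation-lower u ρ x≤cc x≤ρ)) ∧-≤-app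
  denotation-lower cc ρ x≤cc x≤ρ = x≤cc

  cc-top→closed-terms-top : ccᴬ H ≡ ⊤ₐ → ∀ (t : Term 0) → ⟦_⟧₀ H t ≡ ⊤ₐ
  cc-top→closed-terms-top cc≡⊤ t =
    ⊤-unique (denotation-lower t (λ ()) (subst (⊤ₐ ≤_) (sym cc≡⊤) ≤-refl) λ ())

proposition2p27 : (H : CompleteHeytingAlgebra) →
    let open CompleteHeytingAlgebra H in
    (IsBoolean H ⇔ (ccᴬ H ≡ ⊤ₐ)) × ((ccᴬ H ≡ ⊤ₐ) ⇔ (∀ (t : Term 0) → ⟦_⟧₀ H t ≡ ⊤ₐ))
proposition2p27 H =
    mk⇔ (λ boolean → peirce→cc-top (boolean→peirce boolean))
        (λ cc≡⊤ → peirce→boolean (cc-top→peirce cc≡⊤))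
  , mk⇔ cc-top→closed-terms-top (λ all-top → all-top cc)
  where open HeytingFacts H
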